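{- Let $p\geq 5$ be a prime number, $n\geq 1$ an integer and $k\in\{0,1,\ldots,p-1\}$. Then $$\binom{np^{2}-1}{k}_{2}\equiv \begin{cases} 1 \pmod{p^{2}} & \text{if } k\equiv 0 \pmod 3,\\ -1 \pmod{p^{2}} & \text{if } k\equiv 1 \pmod 3,\\ 0 \pmod{p^{2}} & \text{if } k\equiv 2 \pmod 3.\end{cases}$$
   Context: For a nonnegative integer $m$, the trinomial coefficients $\binom{m}{k}_2$ are defined by $(1+x+x^2)^m=\sum_{k=0}^{2m}\binom{m}{k}_2x^k$. -}

module Defs where

open import Data.Nat using (ℕ; zero; suc; _+_; _*_)
open import Data.List using (List; []; _∷_; replicate)

-- Polynomials over ℕ as coefficient lists (lowest degree first).
Poly : Set
Poly = List ℕ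

_⊕_ : Poly → Poly → Poly
[] ⊕ q = q
(a ∷ p) ⊕ [] = a ∷ p
(a ∷ p) ⊕ (b ∷ q) = (a + b) ∷ (p ⊕ q)

_·_ : ℕ → Poly → Poly
c · [] = []
c · (a ∷ p) = (c * a) ∷ (c · p)

_⊗_ : Poly → Poly → Poly
[] ⊗ q = []
(a ∷ p) ⊗ q = (a · q) ⊕ (0 ∷ (p ⊗ q))

_^ₚ_ : Poly → ℕ → Poly
p ^ₚ zero = 1 ∷ []
p ^ₚ suc m = p ⊗ (p ^ₚ m)

coeff : Poly → ℕ → ℕ
coeff [] k = 0
coeff (a ∷ p) zero = a
coeff (a ∷ p) (suc k) = coeff p k

trinomialBase : Poly
trinomialBase = 1 ∷ 1 ∷ 1 ∷ []

trinom : ℕ → ℕ → ℕ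
trinom m k = coeff (trinomialBase ^ₚ m) k

-- Let f = 1 + x + x² and N = n p². Since (f^N)' = N f' f^(N-1) with f' = 1 + 2x,
-- k·[x^k] f^N = N·([x^(k-1)] f^(N-1) + 2·[x^(k-2)] f^(N-1)), so p² divides [x^k] f^N for 0 < k < p.
-- As f^N = f · f^(N-1), the coefficients c_k of f^(N-1) then satisfy c_k + c_(k-1) + c_(k-2) ≡ 0
-- (mod p²) for 2 ≤ k < p, and with c_0 = 1, c_1 = N - 1 ≡ -1 this recurrence forces the period-3
-- pattern 1, -1, 0 of the coefficients of 1/f = (1 - x)/(1 - x³).
module Submission where

open import Defs
open import Data.Nat using (ℕ; _*_; _∸_; _<_; _≥_; _%_; _^_)
open import Data.Nat.Primality using (Prime)
open import Data.Integer using (ℤ; +_; -_; _-_)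
open import Data.Integer.Divisibility using (_∣_)
open import Relation.Binary.PropositionalEquality using (_≡_)
open import Data.Product using (_×_)

open import Data.Nat using (zero; suc; _+_; s≤s)
open import Data.Nat.Properties
  using (+-identityʳ; +-comm; +-assoc; *-zeroʳ; *-identityʳ; ≤-trans; n<1+n; m<n⇒m<1+n)
open import Data.Nat.Divisibility using (∣-trans; ∣m⇒∣m*n; n∣m*n) renaming (_∣_ to _∣ℕ_)
open import Data.Nat.Coprimality using (Coprime; coprime-divisor; prime⇒coprime; 1-coprimeTo)
open import Data.List using ([]; _∷_)
open import Data.Product using (_,_; proj₁; proj₂)
open import Relation.Binary.PropositionalEquality
  using (refl; sym; trans; cong; cong₂; subst; module ≡-Reasoning)
open import Data.Nat.Tactic.RingSolver using (solve-∀)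
import Data.Integer as ℤ
open import Data.Integer.Properties using (pos-+)
open import Data.Integer.Divisibility.Signed
  using (divides; ∣m∣n⇒∣m-n; ∣ᵤ⇒∣; ∣⇒∣ᵤ) renaming (_∣_ to _∣ℤ_)
import Data.Integer.Tactic.RingSolver as ℤ-Solver

coeff-⊕ : ∀ p q k → coeff (p ⊕ q) k ≡ coeff p k + coeff q k
coeff-⊕ []      q       k       = refl
coeff-⊕ (a ∷ p) []      zero    = sym (+-identityʳ a)
coeff-⊕ (a ∷ p) []      (suc k) = sym (+-identityʳ (coeff p k))
coeff-⊕ (a ∷ p) (b ∷ q) zero    = refl
coeff-⊕ (a ∷ p) (b ∷ q) (suc k) = coeff-⊕ p q k

coeff-· : ∀ c q k → coeff (c · q) k ≡ c * coeff q k
coeff-· c []      k       = sym (*-zeroʳ c)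
coeff-· c (a ∷ q) zero    = refl
coeff-· c (a ∷ q) (suc k) = coeff-· c q k

coeff-∷-⊗ : ∀ a p q k → coeff ((a ∷ p) ⊗ q) k ≡ a * coeff q k + coeff (0 ∷ (p ⊗ q)) k
coeff-∷-⊗ a p q k = trans (coeff-⊕ (a · q) (0 ∷ (p ⊗ q)) k) (cong (_+ _) (coeff-· a q k))

coeff-0∷ : ∀ {p q} → (∀ k → coeff p k ≡ coeff q k) → ∀ k → coeff (0 ∷ p) k ≡ coeff (0 ∷ q) k
coeff-0∷ p≗q zero    = refl
coeff-0∷ p≗q (suc k) = p≗q k

coeff-1∷-⊗ : ∀ p q k → coeff ((1 ∷ p) ⊗ q) k ≡ coeff q k + coeff (0 ∷ (p ⊗ q)) k
coeff-1∷-⊗ p q k = trans (coeff-∷-⊗ 1 p q k) (cong (_+ coeff (0 ∷ (p ⊗ q)) k) (+-identityʳ (coeff q k)))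

coeff-trinomialBase-⊗ : ∀ q k →
  coeff (trinomialBase ⊗ q) k ≡ coeff q k + coeff (0 ∷ q) k + coeff (0 ∷ 0 ∷ q) k
coeff-trinomialBase-⊗ q k = begin
    coeff (trinomialBase ⊗ q) k
  ≡⟨ coeff-1∷-⊗ (1 ∷ 1 ∷ []) q k ⟩
    coeff q k + coeff (0 ∷ ((1 ∷ 1 ∷ []) ⊗ q)) k
  ≡⟨ cong (λ r → coeff q k + r) (quadratic k) ⟩
    coeff q k + (coeff (0 ∷ q) k + coeff (0 ∷ 0 ∷ q) k)
  ≡⟨ sym (+-assoc (coeff q k) _ _) ⟩
    coeff q k + coeff (0 ∷ q) k + coeff (0 ∷ 0 ∷ q) k
  ∎
  where
  open ≡-Reasoning
  linear : ∀ k → coeff ((1 ∷ []) ⊗ q) k ≡ coeff q k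
  linear zero    = trans (coeff-1∷-⊗ [] q zero) (+-identityʳ _)
  linear (suc k) = trans (coeff-1∷-⊗ [] q (suc k)) (+-identityʳ _)
  quadratic : ∀ k → coeff (0 ∷ ((1 ∷ 1 ∷ []) ⊗ q)) k ≡ coeff (0 ∷ q) k + coeff (0 ∷ 0 ∷ q) k
  quadratic zero    = refl
  quadratic (suc k) = trans (coeff-1∷-⊗ (1 ∷ []) q k) (cong (λ r → coeff q k + r) (coeff-0∷ linear k))

-- [x^k] x² f^m, i.e. trinom m (k - 2) read as 0 for k < 2; it keeps the recurrences uniform in k
-- without truncated subtraction, and trinom m k = trinom₂ m (2 + k) holds definitionally.
trinom₂ : ℕ → ℕ → ℕ
trinom₂ m k = coeff (0 ∷ 0 ∷ trinomialBase ^ₚ m) k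

trinom-suc : ∀ m k → trinom (suc m) k ≡ trinom m k + trinom₂ m (suc k) + trinom₂ m k
trinom-suc m = coeff-trinomialBase-⊗ (trinomialBase ^ₚ m)

trinom-0 : ∀ m → trinom m 0 ≡ 1
trinom-0 zero    = refl
trinom-0 (suc m) = trans (trinom-suc m 0) (trans (+-identityʳ _) (trans (+-identityʳ _) (trinom-0 m)))

trinom-1 : ∀ m → trinom m 1 ≡ m
trinom-1 zero    = refl
trinom-1 (suc m) = trans (trinom-suc m 1)
  (trans (+-identityʳ _) (trans (cong₂ _+_ (trinom-1 m) (trinom-0 m)) (+-comm m 1)))

derivative-step : ∀ j m a b c d Z X Y →
  X ≡ a + b + c → Y ≡ b + c + d →
  suc (suc j) * Z ≡ suc m * (a + 2 * b) →
  suc j * X ≡ suc m * (b + 2 * c) →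
  j * Y ≡ suc m * (c + 2 * d) →
  suc (suc j) * (Z + X + Y) ≡ suc (suc m) * (X + 2 * Y)
derivative-step j m a b c d Z X Y refl refl hZ hX hY = begin
    suc (suc j) * (Z + X + Y)
  ≡⟨ expand j Z X Y ⟩
    suc (suc j) * Z + suc j * X + j * Y + (X + 2 * Y)
  ≡⟨ cong₂ _+_ (cong₂ _+_ (cong₂ _+_ hZ hX) hY) refl ⟩
    suc m * (a + 2 * b) + suc m * (b + 2 * c) + suc m * (c + 2 * d) + (X + 2 * Y)
  ≡⟨ collect m a b c d ⟩
    suc (suc m) * (X + 2 * Y)
  ∎
  where
  open ≡-Reasoning
  expand : ∀ j Z X Y → suc (suc j) * (Z + X + Y) ≡ suc (suc j) * Z + suc j * X + j * Y + (X + 2 * Y)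
  expand = solve-∀
  collect : ∀ m a b c d →
    suc m * (a + 2 * b) + suc m * (b + 2 * c) + suc m * (c + 2 * d) + (a + b + c + 2 * (b + c + d))
      ≡ suc (suc m) * (a + b + c + 2 * (b + c + d))
  collect = solve-∀

-- Coefficientwise form of (f^(m+1))' = (m + 1) f^m f' with f' = 1 + 2x.
trinom-derivative : ∀ m k → k * trinom (suc m) k ≡ suc m * (trinom₂ m (suc k) + 2 * trinom₂ m k)
trinom-derivative zero    zero                = refl
trinom-derivative zero    (suc zero)          = refl
trinom-derivative zero    (suc (suc zero))    = refl
trinom-derivative zero    (suc (suc (suc k))) = *-zeroʳ (suc (suc (suc k)))
trinom-derivative (suc m) zero                = sym (*-zeroʳ (suc (suc m)))
trinom-derivative (suc m) (suc zero) rewrite trinom-1 (suc (suc m)) | trinom-0 (suc m) =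
  trans (+-identityʳ _) (sym (*-identityʳ _))
trinom-derivative (suc m) (suc (suc j)) =
  trans (cong (suc (suc j) *_) (trinom-suc (suc m) (suc (suc j))))
    (derivative-step j m (trinom₂ m (3 + j)) (trinom₂ m (2 + j)) (trinom₂ m (1 + j)) (trinom₂ m j)
      (trinom (suc m) (2 + j)) (trinom (suc m) (1 + j)) (trinom (suc m) j)
      (trinom-suc m (1 + j)) (trinom-suc m j)
      (trinom-derivative m (2 + j)) (trinom-derivative m (1 + j)) (trinom-derivative m j))

coprime-*ˡ : ∀ {m n k} → Coprime m k → Coprime n k → Coprime (m * n) k
coprime-*ˡ {m} m⊥k n⊥k (i∣mn , i∣k) = n⊥k (coprime-divisor i⊥m i∣mn , i∣k)
  where
  i⊥m : Coprime _ m
  i⊥m (j∣i , j∣m) = m⊥k (j∣m , ∣-trans j∣i i∣k)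

coprime-^ : ∀ {m k} i → Coprime m k → Coprime (m ^ i) k
coprime-^ zero    m⊥k = 1-coprimeTo _
coprime-^ (suc i) m⊥k = coprime-*ˡ m⊥k (coprime-^ i m⊥k)

trinom-divisible : ∀ {d m k} → Coprime d k → d ∣ℕ suc m → d ∣ℕ trinom (suc m) k
trinom-divisible {d} {m} {k} d⊥k d∣m+1 =
  coprime-divisor d⊥k (subst (d ∣ℕ_) (sym (trinom-derivative m k)) (∣m⇒∣m*n _ d∣m+1))

-- The coefficients of 1/f = (1 - x)/(1 - x³).
residue : ℕ → ℤ
residue 0 = + 1
residue 1 = - + 1
residue 2 = + 0
residue (suc (suc (suc k))) = residue k

residue-sum : ∀ j → residue j ℤ.+ residue (suc j) ℤ.+ residue (suc (suc j)) ≡ + 0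
residue-sum 0 = refl
residue-sum 1 = refl
residue-sum 2 = refl
residue-sum (suc (suc (suc j))) = residue-sum j

residue-%3 : ∀ k → (k % 3 ≡ 0 → residue k ≡ + 1) × (k % 3 ≡ 1 → residue k ≡ - + 1)
                 × (k % 3 ≡ 2 → residue k ≡ + 0)
residue-%3 0 = (λ _ → refl) , (λ ()) , (λ ())
residue-%3 1 = (λ ()) , (λ _ → refl) , (λ ())
residue-%3 2 = (λ ()) , (λ ()) , (λ _ → refl)
residue-%3 (suc (suc (suc k))) = residue-%3 k

∣-three-term-recurrence : ∀ {d} a b c x y z → x ℤ.+ y ℤ.+ z ≡ + 0 →
  d ∣ℤ a ℤ.+ b ℤ.+ c → d ∣ℤ b - y → d ∣ℤ c - x → d ∣ℤ a - z
∣-three-term-recurrence {d} a b c x y z x+y+z≡0 d∣a+b+c d∣b-y d∣c-x =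
  subst (d ∣ℤ_) (rearrange a b c x y z)
    (∣m∣n⇒∣m-n (∣m∣n⇒∣m-n (∣m∣n⇒∣m-n d∣a+b+c d∣b-y) d∣c-x)
      (subst (d ∣ℤ_) (sym x+y+z≡0) (divides (+ 0) refl)))
  where
  rearrange : ∀ a b c x y z → (a ℤ.+ b ℤ.+ c) - (b - y) - (c - x) - (x ℤ.+ y ℤ.+ z) ≡ a - z
  rearrange = ℤ-Solver.solve-∀

trinom-suc-ℤ : ∀ m k →
  + trinom (suc m) (2 + k) ≡ + trinom m (2 + k) ℤ.+ + trinom m (1 + k) ℤ.+ + trinom m k
trinom-suc-ℤ m k = begin
    + trinom (suc m) (2 + k)
  ≡⟨ cong +_ (trinom-suc m (2 + k)) ⟩
    + (trinom m (2 + k) + trinom m (1 + k) + trinom m k)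
  ≡⟨ pos-+ (trinom m (2 + k) + trinom m (1 + k)) (trinom m k) ⟩
    + (trinom m (2 + k) + trinom m (1 + k)) ℤ.+ + trinom m k
  ≡⟨ cong (ℤ._+ + trinom m k) (pos-+ (trinom m (2 + k)) (trinom m (1 + k))) ⟩
    + trinom m (2 + k) ℤ.+ + trinom m (1 + k) ℤ.+ + trinom m k
  ∎
  where open ≡-Reasoning

trinom-≡-residue : ∀ {d} m k → d ∣ℕ suc m → (∀ i → i < k → Coprime d (suc i)) →
  + d ∣ℤ + trinom m k - residue k
trinom-≡-residue m zero d∣m+1 d⊥ rewrite trinom-0 m = divides (+ 0) refl
trinom-≡-residue {d} m (suc zero) d∣m+1 d⊥ rewrite trinom-1 m =
  subst (+ d ∣ℤ_) (trans (cong +_ (+-comm 1 m)) (pos-+ m 1)) (∣ᵤ⇒∣ d∣m+1)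
trinom-≡-residue {d} m (suc (suc j)) d∣m+1 d⊥ =
  ∣-three-term-recurrence (+ trinom m (2 + j)) (+ trinom m (1 + j)) (+ trinom m j)
    (residue j) (residue (1 + j)) (residue (2 + j)) (residue-sum j)
    (subst (+ d ∣ℤ_) (trinom-suc-ℤ m j)
      (∣ᵤ⇒∣ (trinom-divisible (d⊥ (suc j) (n<1+n (suc j))) d∣m+1)))
    (trinom-≡-residue m (suc j) d∣m+1 (λ i i<1+j → d⊥ i (m<n⇒m<1+n i<1+j)))
    (trinom-≡-residue m j d∣m+1 (λ i i<j → d⊥ i (m<n⇒m<1+n (m<n⇒m<1+n i<j))))

corollary1 : (p n k : ℕ) → Prime p → p ≥ 5 → n ≥ 1 → k < p →
    ((k % 3 ≡ 0 → (+ (p ^ 2)) ∣ ((+ trinom (n * p ^ 2 ∸ 1) k) - (+ 1)))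
    × (k % 3 ≡ 1 → (+ (p ^ 2)) ∣ ((+ trinom (n * p ^ 2 ∸ 1) k) - (- (+ 1))))
    × (k % 3 ≡ 2 → (+ (p ^ 2)) ∣ ((+ trinom (n * p ^ 2 ∸ 1) k) - (+ 0))))
-- Matching p and n on suc makes
-- suc (n * p ^ 2 ∸ 1) reduce to n * p ^ 2.
corollary1 p@(suc _) n@(suc _) k p-prime _ _ k<p =
  (λ h → congruent (proj₁ (residue-%3 k) h)) ,
  (λ h → congruent (proj₁ (proj₂ (residue-%3 k)) h)) ,
  (λ h → congruent (proj₂ (proj₂ (residue-%3 k)) h))
  where
  p²⊥ : ∀ i → i < k → Coprime (p ^ 2) (suc i)
  p²⊥ i i<k = coprime-^ 2 (prime⇒coprime p-prime (≤-trans (s≤s i<k) k<p))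
  congruent : ∀ {r} → residue k ≡ r → + (p ^ 2) ∣ + trinom (n * p ^ 2 ∸ 1) k - r
  congruent refl = ∣⇒∣ᵤ (trinom-≡-residue (n * p ^ 2 ∸ 1) k (n∣m*n n) p²⊥)
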